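{- For all terms $r,s$: if $r\rightleftarrows s$ then $M(r)=M(s)$.
   Context: Types: $A,B,C::=\tau\mid A\Rightarrow B\mid A\wedge B$ with a single atomic type $\tau$. $\equiv$ is the smallest congruence on types containing $A\wedge B\equiv B\wedge A$, $(A\wedge B)\wedge C\equiv A\wedge(B\wedge C)$, $A\Rightarrow(B\wedge C)\equiv(A\Rightarrow B)\wedge(A\Rightarrow C)$, $(A\wedge B)\Rightarrow C\equiv A\Rightarrow B\Rightarrow C$. Terms: $r,s,t::=x^A\mid \lambda x^A.r\mid r\,s\mid r+s\mid \pi_A(r)$; every variable occurrence carries a type label; terms up to $\alpha$-equivalence. $\mathrm{vars}(r)$ is the set of labelled variables of $r$; a set of labelled variables is functional if $x^A,x^B$ in it implies $A=B$. $r[A/B]$ replaces every syntactic occurrence of type $B$ in $r$ by $A$. Typing (judgements $r:A$): $x^A:A$; if $r:A$ and $A\equiv B$ then $r:B$; if $r:B$ and $\mathrm{vars}(r)\cup\{x^A\}$ functional then $\lambda x^A.r:A\Rightarrow B$; if $r:A\Rightarrow B$, $s:A$, $\mathrm{vars}(rs)$ functional then $rs:B$; if $r:A$, $s:B$, $\mathrm{vars}(r+s)$ functional then $r+s:A\wedge B$; if $r:A$ then $\pi_A(r):A$; if $r:A\wedge B$ then $\pi_A(r):A$. The relation $\rightleftarrows$ is the closure under contexts $C[\cdot]::=[\cdot]\mid\lambda x^A.C[\cdot]\mid C[\cdot]r\mid rC[\cdot]\mid C[\cdot]+r\mid r+C[\cdot]\mid\pi_A(C[\cdot])$ of the following rules,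 each used in both directions: $r+s\rightleftarrows s+r$; $(r+s)+t\rightleftarrows r+(s+t)$; $\lambda x^A.(r+s)\rightleftarrows\lambda x^A.r+\lambda x^A.s$; $(r+s)t\rightleftarrows rt+st$; $\pi_{A\Rightarrow B}(\lambda x^A.r)\rightleftarrows\lambda x^A.\pi_B(r)$; if $r:A\Rightarrow(B\wedge C)$ then $\pi_{A\Rightarrow B}(r)s\rightleftarrows\pi_B(rs)$; $(rs)t\rightleftarrows r(s+t)$; if $A\equiv B$ then $r\rightleftarrows r[A/B]$; if $r:A\wedge B$ and $s:C\wedge D$ then $\pi_{A\wedge C}(r+s)\rightleftarrows\pi_A(r)+\pi_C(s)$. $P$: $P(x^A)=0$, $P(\lambda x^A.r)=P(r)$, $P(rs)=P(r)$, $P(r+s)=1+P(r)+P(s)$, $P(\pi_A(r))=P(r)$. $M$: $M(x^A)=1$, $M(\lambda x^A.r)=1+M(r)+P(r)$, $M(rs)=M(r)+M(s)+P(r)M(s)$, $M(r+s)=M(r)+M(s)$, $M(\pi_A(r))=1+M(r)+P(r)$. -}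

module Defs where

open import Data.Nat using (ℕ; zero; suc; _+_; _*_)
open import Data.Product using (_×_; _,_)
open import Data.List using (List; []; _∷_; _++_)
open import Data.List.Membership.Propositional using (_∈_)
open import Relation.Binary.PropositionalEquality using (_≡_; refl; cong; cong₂)
open import Relation.Nullary using (Dec; yes; no; ¬_)

infixr 7 _⇒_
infixr 8 _∧_

data Ty : Set where
  τ   : Ty
  _⇒_ : Ty → Ty → Ty
  _∧_ : Ty → Ty → Ty

_≟T_ : (A B : Ty) → Dec (A ≡ B)
τ ≟T τ = yes refl
τ ≟T (_ ⇒ _) = no λ ()
τ ≟T (_ ∧ _) = no λ ()
(_ ⇒ _) ≟T τ = no λ ()
(_ ⇒ _) ≟T (_ ∧ _) = no λ ()
(A ⇒ B) ≟T (C ⇒ D) with A ≟T C | B ≟T D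
... | yes refl | yes refl = yes refl
... | no ne | _ = no λ { refl → ne refl }
... | yes _ | no ne = no λ { refl → ne refl }
(_ ∧ _) ≟T τ = no λ ()
(_ ∧ _) ≟T (_ ⇒ _) = no λ ()
(A ∧ B) ≟T (C ∧ D) with A ≟T C | B ≟T D
... | yes refl | yes refl = yes refl
... | no ne | _ = no λ { refl → ne refl }
... | yes _ | no ne = no λ { refl → ne refl }

infix 4 _≅_
data _≅_ : Ty → Ty → Set where
  ≅-refl  : ∀ {A} → A ≅ A
  ≅-sym   : ∀ {A B} → A ≅ B → B ≅ A
  ≅-trans : ∀ {A B C} → A ≅ B → B ≅ C → A ≅ C
  ≅-⇒     : ∀ {A A′ B B′} → A ≅ A′ → B ≅ B′ → (A ⇒ B) ≅ (A′ ⇒ B′)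
  ≅-∧     : ∀ {A A′ B B′} → A ≅ A′ → B ≅ B′ → (A ∧ B) ≅ (A′ ∧ B′)
  ≅-comm  : ∀ {A B} → (A ∧ B) ≅ (B ∧ A)
  ≅-assoc : ∀ {A B C} → ((A ∧ B) ∧ C) ≅ (A ∧ (B ∧ C))
  ≅-dist  : ∀ {A B C} → (A ⇒ (B ∧ C)) ≅ ((A ⇒ B) ∧ (A ⇒ C))
  ≅-curry : ∀ {A B C} → ((A ∧ B) ⇒ C) ≅ (A ⇒ (B ⇒ C))

-- Terms (raw, named variables ℕ, every variable occurrence labelled)

infixl 6 _⊕_

data Tm : Set where
  var : ℕ → Ty → Tm
  lam : ℕ → Ty → Tm → Tm
  app : Tm → Tm → Tm
  _⊕_ : Tm → Tm → Tm
  π   : Ty → Tm → Tm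

vars : Tm → List (ℕ × Ty)
vars (var x A)   = (x , A) ∷ []
vars (lam x A r) = (x , A) ∷ vars r
vars (app r s)   = vars r ++ vars s
vars (r ⊕ s)     = vars r ++ vars s
vars (π A r)     = vars r

Functional : List (ℕ × Ty) → Set
Functional V = ∀ {x A B} → (x , A) ∈ V → (x , B) ∈ V → A ≡ B

substTy : Ty → Ty → Ty → Ty
substTy A B C with C ≟T B
... | yes _ = A
substTy A B τ       | no _ = τ
substTy A B (C ⇒ D) | no _ = substTy A B C ⇒ substTy A B D
substTy A B (C ∧ D) | no _ = substTy A B C ∧ substTy A B D

substTm : Ty → Ty → Tm → Tm
substTm A B (var x C)   = var x (substTy A B C)
substTm A B (lam x C r) = lam x (substTy A B C) (substTm A B r)
substTm A B (app r s)   = app (substTm A B r) (substTm A B s)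
substTm A B (r ⊕ s)     = substTm A B r ⊕ substTm A B s
substTm A B (π C r)     = π (substTy A B C) (substTm A B r)

infix 4 _∶_
data _∶_ : Tm → Ty → Set where
  ty-var  : ∀ {x A} → var x A ∶ A
  ty-conv : ∀ {r A B} → r ∶ A → A ≅ B → r ∶ B
  ty-lam  : ∀ {x A r B} → r ∶ B → Functional ((x , A) ∷ vars r) →
            lam x A r ∶ (A ⇒ B)
  ty-app  : ∀ {r s A B} → r ∶ (A ⇒ B) → s ∶ A → Functional (vars (app r s)) →
            app r s ∶ B
  ty-sum  : ∀ {r s A B} → r ∶ A → s ∶ B → Functional (vars (r ⊕ s)) →
            (r ⊕ s) ∶ (A ∧ B)
  ty-π    : ∀ {r A} → r ∶ A → π A r ∶ A
  ty-πl   : ∀ {r A B} → r ∶ (A ∧ B) → π A r ∶ A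

infix 4 _↦_
data _↦_ : Tm → Tm → Set where
  r-comm   : ∀ {r s} → (r ⊕ s) ↦ (s ⊕ r)
  r-assoc  : ∀ {r s t} → ((r ⊕ s) ⊕ t) ↦ (r ⊕ (s ⊕ t))
  r-distλ  : ∀ {x A r s} → lam x A (r ⊕ s) ↦ (lam x A r ⊕ lam x A s)
  r-distap : ∀ {r s t} → app (r ⊕ s) t ↦ (app r t ⊕ app s t)
  r-πλ     : ∀ {x A B r} → π (A ⇒ B) (lam x A r) ↦ lam x A (π B r)
  r-πapp   : ∀ {r s A B C} → r ∶ (A ⇒ (B ∧ C)) →
             app (π (A ⇒ B) r) s ↦ π B (app r s)
  r-curry  : ∀ {r s t} → app (app r s) t ↦ app r (s ⊕ t)
  r-subst  : ∀ {r A B} → A ≅ B → r ↦ substTm A B r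
  r-πsum   : ∀ {r s A B C D} → r ∶ (A ∧ B) → s ∶ (C ∧ D) →
             π (A ∧ C) (r ⊕ s) ↦ (π A r ⊕ π C s)

infix 4 _⇄_
data _⇄_ : Tm → Tm → Set where
  fwd   : ∀ {r s} → r ↦ s → r ⇄ s
  bwd   : ∀ {r s} → s ↦ r → r ⇄ s
  c-lam : ∀ {x A r s} → r ⇄ s → lam x A r ⇄ lam x A s
  c-appl : ∀ {r s t} → r ⇄ s → app r t ⇄ app s t
  c-appr : ∀ {r s t} → r ⇄ s → app t r ⇄ app t s
  c-suml : ∀ {r s t} → r ⇄ s → (r ⊕ t) ⇄ (s ⊕ t)
  c-sumr : ∀ {r s t} → r ⇄ s → (t ⊕ r) ⇄ (t ⊕ s)
  c-π    : ∀ {A r s} → r ⇄ s → π A r ⇄ π A s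

P : Tm → ℕ
P (var _ _)   = 0
P (lam _ _ r) = P r
P (app r s)   = P r
P (r ⊕ s)     = 1 + P r + P s
P (π _ r)     = P r

M : Tm → ℕ
M (var _ _)   = 1
M (lam _ _ r) = 1 + M r + P r
M (app r s)   = M r + M s + P r * M s
M (r ⊕ s)     = M r + M s
M (π _ r)     = 1 + M r + P r

-- P counts the occurrences of + in a term, and the rules only move sums
-- around (type substitution leaves the term shape unchanged), so P is
-- invariant under ⇄.  Knowing that, each rule's effect on M is a semiring
-- identity in the values of M and P on its metavariables.
module Submission where

open import Data.Nat using (suc; _+_; _*_)
open import Data.Nat.Properties using (+-comm; +-assoc)
open import Data.Nat.Tactic.RingSolver using (solve-∀)
open import Relation.Binary.PropositionalEquality
  using (_≡_; refl; sym; cong; cong₂)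

open import Defs

P-substTm : ∀ A B r → P (substTm A B r) ≡ P r
P-substTm A B (var x C)   = refl
P-substTm A B (lam x C r) = P-substTm A B r
P-substTm A B (app r s)   = P-substTm A B r
P-substTm A B (r ⊕ s)     = cong₂ (λ p q → suc (p + q)) (P-substTm A B r) (P-substTm A B s)
P-substTm A B (π C r)     = P-substTm A B r

M-substTm : ∀ A B r → M (substTm A B r) ≡ M r
M-substTm A B (var x C)   = refl
M-substTm A B (lam x C r) = cong₂ (λ m p → suc (m + p)) (M-substTm A B r) (P-substTm A B r)
M-substTm A B (app r s)   =
  cong₂ _+_ (cong₂ _+_ (M-substTm A B r) (M-substTm A B s))
            (cong₂ _*_ (P-substTm A B r) (M-substTm A B s))
M-substTm A B (r ⊕ s)     = cong₂ _+_ (M-substTm A B r) (M-substTm A B s)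
M-substTm A B (π C r)     = cong₂ (λ m p → suc (m + p)) (M-substTm A B r) (P-substTm A B r)

P-↦ : ∀ {r s} → r ↦ s → P r ≡ P s
P-↦ (r-comm {r} {s})          = cong suc (+-comm (P r) (P s))
P-↦ (r-assoc {r} {s} {t})     = cong suc (suc-assoc (P r) (P s) (P t))
  where
  suc-assoc : ∀ a b c → suc (a + b) + c ≡ a + suc (b + c)
  suc-assoc = solve-∀
P-↦ r-distλ                   = refl
P-↦ r-distap                  = refl
P-↦ r-πλ                      = refl
P-↦ (r-πapp _)                = refl
P-↦ r-curry                   = refl
P-↦ (r-subst {r} {A} {B} _)   = sym (P-substTm A B r)
P-↦ (r-πsum _ _)              = refl

P-⇄ : ∀ {r s} → r ⇄ s → P r ≡ P s
P-⇄ (fwd ρ)    = P-↦ ρ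
P-⇄ (bwd ρ)    = sym (P-↦ ρ)
P-⇄ (c-lam h)  = P-⇄ h
P-⇄ (c-appl h) = P-⇄ h
P-⇄ (c-appr h) = refl
P-⇄ (c-suml {t = t} h) = cong (λ p → suc (p + P t)) (P-⇄ h)
P-⇄ (c-sumr {t = t} h) = cong (λ p → suc (P t + p)) (P-⇄ h)
P-⇄ (c-π h)    = P-⇄ h

unary-over-sum : ∀ a b p q → suc (a + b + suc (p + q)) ≡ suc (a + p) + suc (b + q)
unary-over-sum = solve-∀

M-↦ : ∀ {r s} → r ↦ s → M r ≡ M s
M-↦ (r-comm {r} {s})              = +-comm (M r) (M s)
M-↦ (r-assoc {r} {s} {t})         = +-assoc (M r) (M s) (M t)
M-↦ (r-distλ {r = r} {s})         = unary-over-sum (M r) (M s) (P r) (P s)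
M-↦ (r-distap {r} {s} {t})        = distap (M r) (M s) (M t) (P r) (P s)
  where
  distap : ∀ a b c p q → a + b + c + suc (p + q) * c ≡ a + c + p * c + (b + c + q * c)
  distap = solve-∀
M-↦ r-πλ                          = refl
M-↦ (r-πapp {r} {s} _)            = πapp (M r) (P r) (M s)
  where
  πapp : ∀ a p c → suc (a + p) + c + p * c ≡ suc (a + c + p * c + p)
  πapp = solve-∀
M-↦ (r-curry {r} {s} {t})         = curry (M r) (M s) (M t) (P r)
  where
  curry : ∀ a b c p → a + b + p * b + c + p * c ≡ a + (b + c) + p * (b + c)
  curry = solve-∀
M-↦ (r-subst {r} {A} {B} _)       = sym (M-substTm A B r)
M-↦ (r-πsum {r} {s} _ _)          = unary-over-sum (M r) (M s) (P r) (P s)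

M-⇄ : ∀ {r s} → r ⇄ s → M r ≡ M s
M-⇄ (fwd ρ)            = M-↦ ρ
M-⇄ (bwd ρ)            = sym (M-↦ ρ)
M-⇄ (c-lam h)          = cong₂ (λ m p → suc (m + p)) (M-⇄ h) (P-⇄ h)
M-⇄ (c-appl {t = t} h) = cong₂ (λ m p → m + M t + p * M t) (M-⇄ h) (P-⇄ h)
M-⇄ (c-appr {t = t} h) = cong (λ m → M t + m + P t * m) (M-⇄ h)
M-⇄ (c-suml {t = t} h) = cong (_+ M t) (M-⇄ h)
M-⇄ (c-sumr {t = t} h) = cong (M t +_) (M-⇄ h)
M-⇄ (c-π h)            = cong₂ (λ m p → suc (m + p)) (M-⇄ h) (P-⇄ h)

lemma3 : ∀ (r s : Tm) → r ⇄ s → M r ≡ M s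
lemma3 r s = M-⇄
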